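{- For every $\varepsilon>0$ and all positive integers $r\geq 3$ and $m$ there exists $k$ such that the following holds: if $H$ is a $(k,r)$-reduced hypergraph with density at least $1/4+\varepsilon$, then there is a set $S\subseteq[k]$ of $m$ indices such that every $(2r-2)$-tuple of indices in $S$ admits the descriptive sequence $X X\cdots X Z Z Y Y\cdots Y$ (consisting of $r-2$ letters $X$, then two letters $Z$, then $r-2$ letters $Y$).
   Context: A $(k,r)$-reduced hypergraph is a $\binom{r}{2}$-uniform hypergraph $H$ whose vertex set is partitioned into nonempty parts $V_{i,j}$, $1\leq i<j\leq k$ (with $V_{j,i}$ meaning $V_{i,j}$), such that for each edge $e$ there are indices $t_1<\dots<t_r$ in $[k]$ for which $e$ has exactly one vertex in each $V_{t_a,t_b}$, $1\leq a<b\leq r$. For $t_1<\dots<t_r$, the constituent $\mathcal{A}_{t_1,\dots,t_r}$ is the $\binom r2$-partite subhypergraph of $H$ induced on the parts $V_{t_a,t_b}$, $1\leq a<b\leq r$. $H$ has density at least $d$ if every constituent $\mathcal{A}_{t_1,\dots,t_r}$ has at least $d\prod_{1\leq a<b\leq r}|V_{t_a,t_b}|$ edges. A descriptive sequence of order $r$ is a sequence $\sigma=(s_1,\dots,s_{2r-2})$ over $\{X,Y,Z\}$ with $r-2$ letters $X$, $r-2$ letters $Y$ and two letters $Z$. For indices $t_1<\dots<t_{2r-2}$ in $[k]$, let $x_1<\dots<x_r$ be the $t_i$ with $s_i\in\{X,Z\}$ and $y_1<\dots<y_r$ be the $t_i$ with $s_i\in\{Y,Z\}$. The tuple $\{t_1,\dots,t_{2r-2}\}$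 admits $\sigma$ (in $H$) if there exist edges $e_X\in\mathcal{A}_{x_1,\dots,x_r}$ and $e_Y\in\mathcal{A}_{y_1,\dots,y_r}$ intersecting in one vertex, this vertex lying in $V_{t_i,t_j}$ where $s_i=s_j=Z$. -}

module Defs where

open import Data.Bool using (Bool; true; false; _∧_; _∨_; not)
open import Data.Nat as ℕ using (ℕ; zero; suc; _∸_)
open import Data.Nat.Combinatorics using (_C_)
open import Data.Integer using (+_)
open import Data.Rational using (ℚ; _/_; _+_; _*_; _≤_)
open import Data.Fin using (Fin; _<_)
open import Data.Fin.Properties using (_≟_)
open import Data.Fin.Subset using (Subset; ∣_∣)
open import Data.Vec using (Vec; []; _∷_; lookup)
open import Data.List using (List; []; _∷_; _++_; map; length; allFin; replicate)
open import Data.Bool.ListAction using (all; any)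
open import Data.Nat.ListAction using (product)
open import Data.List.Membership.Propositional using (_∈_)
open import Data.List.Relation.Unary.Linked using (Linked)
open import Data.Product using (Σ; ∃; _×_; _,_; proj₁; proj₂)
open import Relation.Binary.PropositionalEquality using (_≡_)
open import Relation.Nullary.Decidable using (⌊_⌋)

allSubsets : (n : ℕ) → List (Subset n)
allSubsets zero = [] ∷ []
allSubsets (suc n) = map (false ∷_) (allSubsets n) ++ map (true ∷_) (allSubsets n)

count : ∀ {A : Set} → (A → Bool) → List A → ℕ
count P [] = 0
count P (x ∷ xs) with P x
... | true  = suc (count P xs)
... | false = count P xs

pairsOf : ∀ {A : Set} → List A → List (A × A)
pairsOf [] = []
pairsOf (a ∷ xs) = map (a ,_) xs ++ pairsOf xs

IncTuple : (k s : ℕ) → List (Fin k) → Set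
IncTuple k s t = length t ≡ s × Linked _<_ t

-- (k,r)-reduced hypergraphs.
-- Vertex set Fin n; vertex v lies in the part V_{p₁ v , p₂ v} with p₁ v < p₂ v.
-- Edges form a (decidable) set of vertex subsets.

record ReducedHG (k r : ℕ) : Set where
  field
    n        : ℕ
    p₁ p₂    : Fin n → Fin k
    ordered  : ∀ v → p₁ v < p₂ v
    nonempty : ∀ (i j : Fin k) → i < j → ∃ λ v → p₁ v ≡ i × p₂ v ≡ j
    edge     : Subset n → Bool
    uniform  : ∀ e → edge e ≡ true → ∣ e ∣ ≡ r C 2
    reduced  : ∀ e → edge e ≡ true →
               ∃ λ (t : List (Fin k)) → IncTuple k r t ×
                 (∀ a b → (a , b) ∈ pairsOf t →
                    ∃ λ v → (lookup e v ≡ true × p₁ v ≡ a × p₂ v ≡ b) ×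
                      (∀ w → lookup e w ≡ true → p₁ w ≡ a → p₂ w ≡ b → w ≡ v))

module _ {k r : ℕ} (H : ReducedHG k r) where
  open ReducedHG H

  inPart : Fin k → Fin k → Fin n → Bool
  inPart a b v = ⌊ p₁ v ≟ a ⌋ ∧ ⌊ p₂ v ≟ b ⌋

  inUnion : List (Fin k) → Fin n → Bool
  inUnion t v = any (λ ab → inPart (proj₁ ab) (proj₂ ab) v) (pairsOf t)

  inConst : List (Fin k) → Subset n → Bool
  inConst t e = edge e ∧ all (λ v → not (lookup e v) ∨ inUnion t v) (allFin n)

  edgeCount : List (Fin k) → ℕ
  edgeCount t = count (inConst t) (allSubsets n)

  partSize : Fin k → Fin k → ℕ
  partSize a b = count (inPart a b) (allFin n)

  partProduct : List (Fin k) → ℕ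
  partProduct t = product (map (λ ab → partSize (proj₁ ab) (proj₂ ab)) (pairsOf t))

  HasDensity : ℚ → Set
  HasDensity d = ∀ t → IncTuple k r t →
    d * ((+ partProduct t) / 1) ≤ (+ edgeCount t) / 1

data Letter : Set where
  X Y Z : Letter

isXZ : Letter → Bool
isXZ X = true
isXZ Y = false
isXZ Z = true

isYZ : Letter → Bool
isYZ X = false
isYZ Y = true
isYZ Z = true

isZ : Letter → Bool
isZ Z = true
isZ _ = false

select : ∀ {A : Set} → (Letter → Bool) → List Letter → List A → List A
select P [] _ = []
select P (_ ∷ _) [] = []
select P (s ∷ σ) (t ∷ ts) with P s
... | true  = t ∷ select P σ ts
... | false = select P σ ts

XZZY : ℕ → List Letter
XZZY r = replicate (r ∸ 2) X ++ Z ∷ Z ∷ replicate (r ∸ 2) Y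

Admits : ∀ {k r} → ReducedHG k r → List Letter → List (Fin k) → Set
Admits H σ t =
  Σ (Subset n) λ eX → Σ (Subset n) λ eY → Σ (Fin n) λ v →
    inConst H (select isXZ σ t) eX ≡ true ×
    inConst H (select isYZ σ t) eY ≡ true ×
    (∀ w → (lookup eX w ∧ lookup eY w) ≡ true → w ≡ v) ×
    lookup eX v ≡ true × lookup eY v ≡ true ×
    select isZ σ t ≡ p₁ v ∷ p₂ v ∷ []
  where open ReducedHG H

{-# OPTIONS --safe #-}
-- Let 1/D ≤ ε. Colour every r-tuple T of indices by ⌊D·b/B⌋, where B is the size of the part
-- of the last pair of T and b the number of its vertices lying in an edge of the constituent
-- A_T. By Ramsey's theorem some m indices carry r-tuples of a single colour c only. Split a
-- (2r−2)-tuple of them as x z₁ z₂ y and put T₁ = x z₁ z₂, T₂ = z₁ z₂ y. The colour of T₁ says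
-- that a fraction at least c/D of V_{z₁z₂} is covered by A_{T₁}. An edge of A_{T₂} has one
-- vertex in each of its parts, so A_{T₂} has at most as many edges as the product of the
-- numbers of covered vertices; density above 1/4 + 1/D and the colour of T₂ on its last part
-- then force so many covered vertices in V_{z₁z₂} that, as (c + d + 4)(c + d) > 4(c + 1)d for
-- D = c + d, the two covered sets meet. A common vertex lies in an edge of A_{T₁} and an edge
-- of A_{T₂}, and these can only share the part V_{z₁z₂}, in which each has a single vertex.
module Submission where

module Ramsey where

  open import Data.Nat using (ℕ; zero; suc; pred; _+_; _≤_; s≤s; NonZero; ≢-nonZero)
  open import Data.Nat.Properties
    using (_≟_; ≤-trans; ≤-reflexive; m≤m+n; m≤n+m; m≤n⇒m⊓n≡m; +-suc; suc-pred; suc-injective; n≤0⇒n≡0;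
           +-0-monoid)
  open import Algebra.Properties.Monoid.Sum +-0-monoid using (sum)
  open import Data.Fin using (Fin; zero; suc)
  open import Data.Fin.Properties using (any?) renaming (_≟_ to _≟ᶠ_)
  open import Data.List using (List; []; _∷_; length; take)
  open import Data.List.Properties using (length-take)
  open import Data.List.Relation.Binary.Sublist.Propositional using (_⊆_; []; _∷_; _∷ʳ_; ⊆-trans; minimum)
  open import Data.List.Relation.Binary.Sublist.Propositional.Properties using (take-⊆)
  open import Data.Vec.Functional using (Vector; tail; updateAt)
  open import Data.Vec.Functional.Properties using (updateAt-updates; updateAt-minimal)
  open import Data.Product using (∃; ∃₂; _×_; _,_; proj₁; proj₂)
  open import Relation.Nullary using (yes; no)
  open import Relation.Binary.PropositionalEquality using (_≡_; refl; sym; trans; cong; subst)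

  ≤-sum : ∀ {c} (m : Vector ℕ c) i → m i ≤ sum m
  ≤-sum m zero    = m≤m+n (m zero) _
  ≤-sum m (suc i) = ≤-trans (≤-sum (tail m) i) (m≤n+m _ (m zero))

  sum-updateAt-pred : ∀ {c} (m : Vector ℕ c) i .{{_ : NonZero (m i)}} →
                      suc (sum (updateAt m i pred)) ≡ sum m
  sum-updateAt-pred m zero    = cong (_+ sum (tail m)) (suc-pred (m zero))
  sum-updateAt-pred m (suc i) = trans (sym (+-suc (m zero) _)) (cong (m zero +_) (sum-updateAt-pred (tail m) i))

  Monochromatic : {A : Set} {c : ℕ} → (List A → Fin c) → ℕ → Fin c → List A → Set
  Monochromatic f r i Y = ∀ T → T ⊆ Y → length T ≡ r → f T ≡ i

  IsRamseyBound : (r c : ℕ) → Vector ℕ c → ℕ → Set₁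
  IsRamseyBound r c m N = ∀ {A : Set} (L : List A) → N ≤ length L → (f : List A → Fin c) →
    ∃₂ λ i Y → Y ⊆ L × length Y ≡ m i × Monochromatic f r i Y

  ramsey-zero : ∀ {c} (m : Vector ℕ c) → IsRamseyBound 0 c m (sum m)
  ramsey-zero m L Σm≤∣L∣ f =
    f [] , take (m (f [])) L , take-⊆ _ L ,
    trans (length-take _ L) (m≤n⇒m⊓n≡m (≤-trans (≤-sum m (f [])) Σm≤∣L∣)) ,
    λ { [] _ _ → refl }

  empty-monochromatic : ∀ {A : Set} {c r} (f : List A → Fin c) i → Monochromatic f (suc r) i []
  empty-monochromatic f i [] [] ()

  -- Take out the first element v; inside an i-monochromatic set for U ↦ f (v ∷ U)
  -- find either a j-monochromatic set of size m j with j ≢ i, or an i-monochromatic one of size m i − 1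
  -- that v extends.
  ramsey-suc : ∀ {r c} → (∀ m → ∃ (IsRamseyBound r c m)) →
               ∀ t (m : Vector ℕ c) → sum m ≡ t → ∃ (IsRamseyBound (suc r) c m)
  ramsey-suc R zero m Σm≡0 = 0 , λ L _ f →
    f [] , [] , minimum L , sym (n≤0⇒n≡0 (subst (m (f []) ≤_) Σm≡0 (≤-sum m (f [])))) ,
    empty-monochromatic f (f [])
  ramsey-suc {r} {c} R (suc t) m Σm≡1+t with any? (λ i → m i ≟ 0)
  ... | yes (i , mᵢ≡0) = 0 , λ L _ f → i , [] , minimum L , sym mᵢ≡0 , empty-monochromatic f i
  ... | no m≢0 = suc N , bound
    where
    instance
      m-nonZero : ∀ {i} → NonZero (m i)
      m-nonZero {i} = ≢-nonZero (λ mᵢ≡0 → m≢0 (i , mᵢ≡0))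
    IH : ∀ i → ∃ (IsRamseyBound (suc r) c (updateAt m i pred))
    IH i = ramsey-suc R t (updateAt m i pred) (suc-injective (trans (sum-updateAt-pred m i) Σm≡1+t))
    N : ℕ
    N = proj₁ (R (λ i → proj₁ (IH i)))
    bound : IsRamseyBound (suc r) c m (suc N)
    bound [] () f
    bound (v ∷ W) (s≤s N≤∣W∣) f with proj₂ (R _) W N≤∣W∣ (λ U → f (v ∷ U))
    ... | i , Y , Y⊆W , ∣Y∣ , Y-mono with proj₂ (IH i) Y (≤-reflexive (sym ∣Y∣)) f
    ...   | j , Z , Z⊆Y , ∣Z∣ , Z-mono with j ≟ᶠ i
    ...     | no j≢i = j , Z , v ∷ʳ ⊆-trans Z⊆Y Y⊆W , trans ∣Z∣ (updateAt-minimal j i m j≢i) , Z-mono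
    ...     | yes refl = i , v ∷ Z , refl ∷ ⊆-trans Z⊆Y Y⊆W ,
                         trans (cong suc (trans ∣Z∣ (updateAt-updates i m))) (suc-pred (m i)) , vZ-mono
      where
      vZ-mono : Monochromatic f (suc r) i (v ∷ Z)
      vZ-mono T (_ ∷ʳ T⊆Z) ∣T∣ = Z-mono T T⊆Z ∣T∣
      vZ-mono (_ ∷ U) (refl ∷ U⊆Z) ∣T∣ = Y-mono U (⊆-trans U⊆Z Z⊆Y) (suc-injective ∣T∣)

  ramsey : ∀ r c (m : Vector ℕ c) → ∃ (IsRamseyBound r c m)
  ramsey zero    c m = sum m , ramsey-zero m
  ramsey (suc r) c m = ramsey-suc (ramsey r c) (sum m) m refl

module Pairs where

  open import Defs using (pairsOf)
  open import Data.List using (List; []; _∷_; _++_; map; last)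
  open import Data.List.Membership.Propositional using (_∈_)
  open import Data.List.Membership.Propositional.Properties using (∈-++⁻; ∈-++⁺ˡ; ∈-map⁺; ∈-map⁻)
  open import Data.List.Relation.Unary.Any using (here; there)
  import Data.List.Relation.Unary.All as All
  open import Data.List.Relation.Unary.AllPairs using (AllPairs; _∷_)
  open import Data.Maybe using (just)
  open import Data.Product as Product using (∃; ∃₂; _×_; _,_)
  open import Data.Sum using (_⊎_; inj₁; inj₂)
  open import Relation.Binary.Core using (Rel)
  open import Relation.Binary.PropositionalEquality using (_≡_; refl; trans; cong)

  last-++ : ∀ {A : Set} (xs : List A) {ys z} → last ys ≡ just z → last (xs ++ ys) ≡ just z
  last-++ [] eq = eq
  last-++ (x ∷ xs) {ys} eq with xs ++ ys | last-++ xs {ys} eq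
  ... | []    | ()
  ... | _ ∷ _ | eq′ = eq′

  snoc-view : ∀ {A : Set} (x : A) xs → ∃₂ λ ini l → x ∷ xs ≡ ini ++ l ∷ []
  snoc-view x []       = [] , x , refl
  snoc-view x (y ∷ ys) with snoc-view y ys
  ... | ini , l , eq = x ∷ ini , l , cong (x ∷_) eq

  module _ {A : Set} where

    ∈-pairsOf⁻ : ∀ {xs : List A} {a b} → (a , b) ∈ pairsOf xs → a ∈ xs × b ∈ xs
    ∈-pairsOf⁻ {x ∷ xs} ab∈ with ∈-++⁻ (map (x ,_) xs) ab∈
    ... | inj₁ ab∈xxs with ∈-map⁻ (x ,_) ab∈xxs
    ...   | _ , b∈xs , refl = here refl , there b∈xs
    ∈-pairsOf⁻ {x ∷ xs} ab∈ | inj₂ ab∈xs = Product.map there there (∈-pairsOf⁻ ab∈xs)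

    AllPairs⇒pairsOf : ∀ {ℓ} {R : Rel A ℓ} {xs a b} → AllPairs R xs → (a , b) ∈ pairsOf xs → R a b
    AllPairs⇒pairsOf {xs = x ∷ xs} (x∼xs ∷ sxs) ab∈ with ∈-++⁻ (map (x ,_) xs) ab∈
    ... | inj₁ ab∈xxs with ∈-map⁻ (x ,_) ab∈xxs
    ...   | _ , b∈xs , refl = All.lookup x∼xs b∈xs
    AllPairs⇒pairsOf (_ ∷ sxs) ab∈ | inj₂ ab∈xs = AllPairs⇒pairsOf sxs ab∈xs

    ∈⇒∈-pairsOf : ∀ {x a b : A} {xs} → x ∈ a ∷ b ∷ xs →
                  ∃ λ y → (x , y) ∈ pairsOf (a ∷ b ∷ xs) ⊎ (y , x) ∈ pairsOf (a ∷ b ∷ xs)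
    ∈⇒∈-pairsOf {b = b} (here refl) = b , inj₁ (here refl)
    ∈⇒∈-pairsOf {a = a} (there x∈) = a , inj₂ (∈-++⁺ˡ (∈-map⁺ (a ,_) x∈))

    last-pairsOf-++ : ∀ (xs : List A) a b → last (pairsOf (xs ++ a ∷ b ∷ [])) ≡ just (a , b)
    last-pairsOf-++ []       a b = refl
    last-pairsOf-++ (x ∷ xs) a b = last-++ (map (x ,_) (xs ++ a ∷ b ∷ [])) (last-pairsOf-++ xs a b)

    pairsOf-first-last : ∀ (a b y : A) ys → ∃₂ λ mid p →
      pairsOf (a ∷ b ∷ y ∷ ys) ≡ (a , b) ∷ mid ++ p ∷ [] × last (pairsOf (a ∷ b ∷ y ∷ ys)) ≡ just p
    pairsOf-first-last a b y ys with snoc-view (a , y) (map (a ,_) ys ++ pairsOf (b ∷ y ∷ ys))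
    ... | mid , p , eq =
      mid , p , cong ((a , b) ∷_) eq , trans (cong (λ ps → last ((a , b) ∷ ps)) eq) (last-++ ((a , b) ∷ mid) refl)

module SortedLists where

  open import Defs using (pairsOf)
  open import Data.List using ([]; _∷_; _++_)
  open import Data.List.Membership.Propositional using (_∈_)
  open import Data.List.Membership.Propositional.Properties using (∈-++⁻; ∈-++⁺ʳ)
  open import Data.List.Relation.Unary.Any using (here; there)
  import Data.List.Relation.Unary.All as All
  open import Data.List.Relation.Unary.AllPairs using (AllPairs; []; _∷_)
  open import Data.List.Relation.Binary.Sublist.Propositional using (_⊆_; []; _∷_; _∷ʳ_; minimum; ⊆-refl)
  open import Data.List.Relation.Binary.Sublist.Propositional.Properties using (All-resp-⊆; ++⁺ˡ)
  open import Data.Product using (_,_)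
  open import Data.Sum using (_⊎_; inj₁; inj₂)
  open import Data.Empty using (⊥-elim)
  open import Relation.Binary.Core using (Rel)
  open import Relation.Binary.Definitions using (Transitive; Irreflexive)
  open import Relation.Binary.PropositionalEquality using (_≡_; refl)
  open Pairs

  module _ {A : Set} {ℓ} {_<_ : Rel A ℓ} where

    AllPairs-resp-⊆ : ∀ {xs ys} → xs ⊆ ys → AllPairs _<_ ys → AllPairs _<_ xs
    AllPairs-resp-⊆ []          []          = []
    AllPairs-resp-⊆ (_ ∷ʳ τ)    (_ ∷ sys)   = AllPairs-resp-⊆ τ sys
    AllPairs-resp-⊆ (refl ∷ τ)  (y<ys ∷ sys) = All-resp-⊆ τ y<ys ∷ AllPairs-resp-⊆ τ sys

    module _ (<-trans : Transitive _<_) (<-irrefl : Irreflexive _≡_ _<_) where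

      ∈-∷⇒∈-tail : ∀ {y z ys} → y < z → z ∈ y ∷ ys → z ∈ ys
      ∈-∷⇒∈-tail y<z (here refl) = ⊥-elim (<-irrefl refl y<z)
      ∈-∷⇒∈-tail _   (there z∈ys) = z∈ys

      sorted-∈⇒⊆ : ∀ {xs ys} → AllPairs _<_ xs → AllPairs _<_ ys → (∀ {z} → z ∈ xs → z ∈ ys) → xs ⊆ ys
      sorted-∈⇒⊆ {[]}                  _             _             _   = minimum _
      sorted-∈⇒⊆ {x ∷ xs} {[]}         _             _             sub with sub (here refl)
      ... | ()
      sorted-∈⇒⊆ {x ∷ xs} {y ∷ ys}     (x<xs ∷ sxs) (y<ys ∷ sys) sub with sub (here refl)
      ... | here refl  =
        refl ∷ sorted-∈⇒⊆ sxs sys (λ z∈xs → ∈-∷⇒∈-tail (All.lookup x<xs z∈xs) (sub (there z∈xs)))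
      ... | there x∈ys = y ∷ʳ sorted-∈⇒⊆ (x<xs ∷ sxs) sys (λ z∈ → ∈-∷⇒∈-tail (y<z z∈) (sub z∈))
        where
        y<z : ∀ {z} → z ∈ x ∷ xs → y < z
        y<z (here refl)   = All.lookup y<ys x∈ys
        y<z (there z∈xs) = <-trans (All.lookup y<ys x∈ys) (All.lookup x<xs z∈xs)

      AllPairs-++-∈ : ∀ xs {ys x y} → AllPairs _<_ (xs ++ ys) → x ∈ xs → y ∈ ys → x < y
      AllPairs-++-∈ (_ ∷ xs) (x<xsys ∷ _)  (here refl) y∈ys = All.lookup x<xsys (∈-++⁺ʳ xs y∈ys)
      AllPairs-++-∈ (_ ∷ xs) (_ ∷ sxsys)   (there x∈)  y∈ys = AllPairs-++-∈ xs sxsys x∈ y∈ys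

      ∈-both-halves : ∀ xs {z₁ z₂ ys c} → AllPairs _<_ (xs ++ z₁ ∷ z₂ ∷ ys) →
                      c ∈ xs ++ z₁ ∷ z₂ ∷ [] → c ∈ z₁ ∷ z₂ ∷ ys → c ≡ z₁ ⊎ c ≡ z₂
      ∈-both-halves xs sorted c∈₁ c∈₂ with ∈-++⁻ xs c∈₁
      ... | inj₂ (here refl)         = inj₁ refl
      ... | inj₂ (there (here refl)) = inj₂ refl
      ... | inj₁ c∈xs with c∈₂
      ...   | here refl                = inj₁ refl
      ...   | there (here refl)        = inj₂ refl
      ...   | there (there c∈ys)       = ⊥-elim (<-irrefl refl (AllPairs-++-∈ xs sorted c∈xs (there (there c∈ys))))

      pairsOf-both-halves : ∀ xs {z₁ z₂ ys a b} → AllPairs _<_ (xs ++ z₁ ∷ z₂ ∷ ys) →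
        (a , b) ∈ pairsOf (xs ++ z₁ ∷ z₂ ∷ []) → (a , b) ∈ pairsOf (z₁ ∷ z₂ ∷ ys) → (a , b) ≡ (z₁ , z₂)
      pairsOf-both-halves xs {z₁} {z₂} {ys} sorted ab∈₁ ab∈₂ =
        let a∈₁ , b∈₁ = ∈-pairsOf⁻ ab∈₁
            a∈₂ , b∈₂ = ∈-pairsOf⁻ ab∈₂
        in from-halves (AllPairs⇒pairsOf sorted₂ ab∈₂)
                       (∈-both-halves xs sorted a∈₁ a∈₂) (∈-both-halves xs sorted b∈₁ b∈₂)
        where
        sorted₂ : AllPairs _<_ (z₁ ∷ z₂ ∷ ys)
        sorted₂ = AllPairs-resp-⊆ (++⁺ˡ xs ⊆-refl) sorted
        z₁<z₂ : z₁ < z₂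
        z₁<z₂ = AllPairs⇒pairsOf sorted₂ (here refl)
        from-halves : ∀ {a b} → a < b → (a ≡ z₁ ⊎ a ≡ z₂) → (b ≡ z₁ ⊎ b ≡ z₂) → (a , b) ≡ (z₁ , z₂)
        from-halves a<b (inj₁ refl) (inj₂ refl) = refl
        from-halves a<b (inj₁ refl) (inj₁ refl) = ⊥-elim (<-irrefl refl a<b)
        from-halves a<b (inj₂ refl) (inj₂ refl) = ⊥-elim (<-irrefl refl a<b)
        from-halves a<b (inj₂ refl) (inj₁ refl) = ⊥-elim (<-irrefl refl (<-trans z₁<z₂ a<b))

module Counting where

  open import Defs using (count)
  open import Data.Bool using (Bool; true; false; _∧_; _∨_)
  open import Data.Bool.Properties using (T-≡)
  open import Data.Bool.ListAction using (any; all)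
  open import Data.Nat using (ℕ; suc; _+_; _*_; _≤_; _<_; z≤n; s≤s)
  open import Data.Nat.Properties
    using (+-suc; +-comm; +-cancelˡ-≤; +-monoˡ-≤; m≤n⇒m≤1+n; ≤-refl; *-mono-≤; *-mono-<; *-identityʳ;
           module ≤-Reasoning)
  open import Data.Nat.ListAction using (product)
  open import Data.Nat.ListAction.Properties using (product-++)
  open import Data.List using (List; []; _∷_; _++_; map; length; filterᵇ; cartesianProductWith)
  open import Data.List.Properties using (length-++; length-map; length-removeAt′; map-++)
  open import Data.List.Membership.Propositional using (_∈_; find; lose)
  open import Data.List.Membership.Propositional.Properties using (∈-filter⁻; ∈-cartesianProductWith⁺)
  open import Data.List.Relation.Unary.Any using (here; there; index; _─_)
  open import Data.List.Relation.Unary.Any.Properties using (any⁻; any⁺)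
  import Data.List.Relation.Unary.All as All
  open import Data.List.Relation.Unary.All.Properties using (all⁺)
  open import Data.List.Relation.Unary.AllPairs using ([]; _∷_)
  open import Data.List.Relation.Unary.Unique.Propositional using (Unique)
  import Data.List.Relation.Unary.Unique.Propositional.Properties as Unique
  open import Data.List.Relation.Binary.Pointwise using (Pointwise; []; _∷_)
  open import Data.Product as Product using (∃; _×_; _,_)
  open import Data.Empty using (⊥-elim)
  open import Function using (_∘_)
  open import Function.Bundles using (Equivalence)
  open import Relation.Nullary using (contradiction)
  open import Relation.Nullary.Decidable using (T?)
  open import Relation.Binary.PropositionalEquality using (_≡_; _≢_; refl; sym; trans; cong; cong₂; module ≡-Reasoning)

  ∧-true⁻ : ∀ {a b} → a ∧ b ≡ true → a ≡ true × b ≡ true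
  ∧-true⁻ {true} {true} refl = refl , refl

  ∧-true⁺ : ∀ {a b} → a ≡ true → b ≡ true → a ∧ b ≡ true
  ∧-true⁺ refl refl = refl

  module _ {A : Set} (p : A → Bool) where

    any-true⁻ : ∀ xs → any p xs ≡ true → ∃ λ x → x ∈ xs × p x ≡ true
    any-true⁻ xs h = Product.map₂ (Product.map₂ (Equivalence.to T-≡)) (find (any⁻ p xs (Equivalence.from T-≡ h)))

    any-true⁺ : ∀ {x xs} → x ∈ xs → p x ≡ true → any p xs ≡ true
    any-true⁺ x∈xs px = Equivalence.to T-≡ (any⁺ p (lose x∈xs (Equivalence.from T-≡ px)))

    all-true⁻ : ∀ {x xs} → all p xs ≡ true → x ∈ xs → p x ≡ true
    all-true⁻ {xs = xs} h x∈xs = Equivalence.to T-≡ (All.lookup (all⁺ p xs (Equivalence.from T-≡ h)) x∈xs)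

  module _ {A : Set} where

    count-mono : ∀ {P Q : A → Bool} → (∀ x → P x ≡ true → Q x ≡ true) → ∀ xs → count P xs ≤ count Q xs
    count-mono P⇒Q [] = z≤n
    count-mono {P} {Q} P⇒Q (x ∷ xs) with P x in Px | Q x in Qx
    ... | true  | true  = s≤s (count-mono P⇒Q xs)
    ... | true  | false = contradiction (trans (sym (P⇒Q x Px)) Qx) λ ()
    ... | false | true  = m≤n⇒m≤1+n (count-mono P⇒Q xs)
    ... | false | false = count-mono P⇒Q xs

    count-pos : ∀ {P : A → Bool} {x xs} → x ∈ xs → P x ≡ true → 0 < count P xs
    count-pos {P} {xs = y ∷ xs} x∈ Px with P y in Py
    ... | true = s≤s z≤n
    count-pos (here refl) Px | false = contradiction (trans (sym Px) Py) λ ()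
    count-pos (there x∈)  Px | false = count-pos x∈ Px

    count-pos⇒∃ : ∀ (P : A → Bool) xs → 0 < count P xs → ∃ λ x → x ∈ xs × P x ≡ true
    count-pos⇒∃ P (x ∷ xs) pos with P x in Px
    ... | true  = x , here refl , Px
    ... | false = Product.map₂ (Product.map₁ there) (count-pos⇒∃ P xs pos)

    count-∨+count-∧ : ∀ (P Q : A → Bool) xs →
      count P xs + count Q xs ≡ count (λ x → P x ∨ Q x) xs + count (λ x → P x ∧ Q x) xs
    count-∨+count-∧ P Q [] = refl
    count-∨+count-∧ P Q (x ∷ xs) with P x | Q x | count-∨+count-∧ P Q xs
    ... | true  | true  | ih = cong suc (trans (+-suc _ _) (trans (cong suc ih) (sym (+-suc _ _))))
    ... | true  | false | ih = cong suc ih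
    ... | false | true  | ih = trans (+-suc _ _) (cong suc ih)
    ... | false | false | ih = ih

    count-overlap : ∀ {P Q R : A → Bool} →
      (∀ x → P x ≡ true → R x ≡ true) → (∀ x → Q x ≡ true → R x ≡ true) →
      ∀ xs → count R xs < count P xs + count Q xs → ∃ λ x → x ∈ xs × P x ≡ true × Q x ≡ true
    count-overlap {P} {Q} {R} P⇒R Q⇒R xs R<P+Q =
      Product.map₂ (Product.map₂ ∧-true⁻) (count-pos⇒∃ (λ x → P x ∧ Q x) xs (+-cancelˡ-≤ (count R xs) 1 _ (begin
        count R xs + 1                                               ≡⟨ +-comm (count R xs) 1 ⟩
        suc (count R xs)                                             ≤⟨ R<P+Q ⟩
        count P xs + count Q xs                                      ≡⟨ count-∨+count-∧ P Q xs ⟩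
        count (λ x → P x ∨ Q x) xs + count (λ x → P x ∧ Q x) xs      ≤⟨ +-monoˡ-≤ _ (count-mono P∨Q⇒R xs) ⟩
        count R xs + count (λ x → P x ∧ Q x) xs                      ∎)))
      where
      open ≤-Reasoning
      P∨Q⇒R : ∀ x → P x ∨ Q x ≡ true → R x ≡ true
      P∨Q⇒R x _ with P x in Px
      P∨Q⇒R x _  | true  = P⇒R x Px
      P∨Q⇒R x Qx | false = Q⇒R x Qx

    length-filterᵇ : ∀ (P : A → Bool) xs → length (filterᵇ P xs) ≡ count P xs
    length-filterᵇ P [] = refl
    length-filterᵇ P (x ∷ xs) with P x
    ... | true  = cong suc (length-filterᵇ P xs)
    ... | false = length-filterᵇ P xs

    ∈-─⁺ : ∀ {x y : A} {ys} (x∈ys : x ∈ ys) → y ∈ ys → x ≢ y → y ∈ (ys ─ x∈ys)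
    ∈-─⁺ (here refl) (here refl) x≢y = ⊥-elim (x≢y refl)
    ∈-─⁺ (here refl) (there y∈)  _   = y∈
    ∈-─⁺ (there x∈)  (here refl) _   = here refl
    ∈-─⁺ (there x∈)  (there y∈)  x≢y = there (∈-─⁺ x∈ y∈ x≢y)

    Unique⇒length-≤ : ∀ {xs ys : List A} → Unique xs → (∀ {x} → x ∈ xs → x ∈ ys) → length xs ≤ length ys
    Unique⇒length-≤ [] _ = z≤n
    Unique⇒length-≤ {x ∷ xs} {ys} (x∉xs ∷ uxs) xs⊆ys = begin
      suc (length xs)
        ≤⟨ s≤s (Unique⇒length-≤ uxs λ y∈xs → ∈-─⁺ x∈ys (xs⊆ys (there y∈xs)) (All.lookup x∉xs y∈xs)) ⟩
      suc (length (ys ─ x∈ys)) ≡⟨ sym (length-removeAt′ ys (index x∈ys)) ⟩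
      length ys                ∎
      where
      open ≤-Reasoning
      x∈ys : x ∈ ys
      x∈ys = xs⊆ys (here refl)

    count-≤-length : ∀ (P : A → Bool) {xs ys} → Unique xs → (∀ {x} → x ∈ xs → P x ≡ true → x ∈ ys) →
                     count P xs ≤ length ys
    count-≤-length P {xs} {ys} uxs P⊆ys = begin
      count P xs            ≡⟨ sym (length-filterᵇ P xs) ⟩
      length (filterᵇ P xs) ≤⟨ Unique⇒length-≤ (Unique.filter⁺ (T? ∘ P) uxs) filtered⊆ys ⟩
      length ys             ∎
      where
      open ≤-Reasoning
      filtered⊆ys : ∀ {x} → x ∈ filterᵇ P xs → x ∈ ys
      filtered⊆ys x∈ = let x∈xs , Px = ∈-filter⁻ (T? ∘ P) x∈ in P⊆ys x∈xs (Equivalence.to T-≡ Px)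

    choices : List (List A) → List (List A)
    choices []         = [] ∷ []
    choices (xs ∷ xss) = cartesianProductWith _∷_ xs (choices xss)

    length-choices : ∀ xss → length (choices xss) ≡ product (map length xss)
    length-choices []         = refl
    length-choices (xs ∷ xss) =
      trans (length-cartesianProductWith _∷_ xs (choices xss)) (cong (length xs *_) (length-choices xss))
      where
      length-cartesianProductWith : ∀ {B C : Set} (f : A → B → C) xs ys →
                                    length (cartesianProductWith f xs ys) ≡ length xs * length ys
      length-cartesianProductWith f []       ys = refl
      length-cartesianProductWith f (x ∷ xs) ys =
        trans (length-++ (map (f x) ys)) (cong₂ _+_ (length-map (f x) ys) (length-cartesianProductWith f xs ys))

    ∈-choices : ∀ {xs xss} → Pointwise _∈_ xs xss → xs ∈ choices xss
    ∈-choices []            = here refl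
    ∈-choices (x∈ ∷ xs∈xss) = ∈-cartesianProductWith⁺ _∷_ x∈ (∈-choices xs∈xss)

  module _ {B : Set} where

    product-map-mono : ∀ {f g : B → ℕ} ps → (∀ p → f p ≤ g p) → product (map f ps) ≤ product (map g ps)
    product-map-mono []       f≤g = ≤-refl
    product-map-mono (p ∷ ps) f≤g = *-mono-≤ (f≤g p) (product-map-mono ps f≤g)

    product-first-last : ∀ (f : B → ℕ) p mid q →
                         product (map f (p ∷ mid ++ q ∷ [])) ≡ f p * (product (map f mid) * f q)
    product-first-last f p mid q = cong (f p *_) (begin
      product (map f (mid ++ q ∷ []))            ≡⟨ cong product (map-++ f mid (q ∷ [])) ⟩
      product (map f mid ++ f q ∷ [])            ≡⟨ product-++ (map f mid) (f q ∷ []) ⟩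
      product (map f mid) * (f q * 1)            ≡⟨ cong (product (map f mid) *_) (*-identityʳ (f q)) ⟩
      product (map f mid) * f q                  ∎)
      where open ≡-Reasoning

    product-map-pos : ∀ {f : B → ℕ} ps → (∀ {p} → p ∈ ps → 0 < f p) → 0 < product (map f ps)
    product-map-pos []       _   = s≤s z≤n
    product-map-pos (p ∷ ps) pos = *-mono-< (pos (here refl)) (product-map-pos ps (pos ∘ there))

module DescriptiveSequences where

  open import Defs using (select; XZZY; Letter; X; Y; Z)
  open import Data.Bool using (Bool; true; false; if_then_else_)
  open import Data.Nat using (ℕ; zero; suc; _+_)
  open import Data.Nat.Properties using (suc-injective)
  open import Data.List using (List; []; _∷_; _++_; length; replicate)
  open import Data.List.Properties using (length-replicate)
  open import Data.Product using (∃; ∃₂; _×_; _,_)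
  open import Relation.Binary.PropositionalEquality using (_≡_; refl; trans; cong; cong₂; module ≡-Reasoning)

  module _ {A : Set} (P : Letter → Bool) where

    select-++ : ∀ σ₁ σ₂ (ts₁ ts₂ : List A) → length σ₁ ≡ length ts₁ →
                select P (σ₁ ++ σ₂) (ts₁ ++ ts₂) ≡ select P σ₁ ts₁ ++ select P σ₂ ts₂
    select-++ []       σ₂ []        ts₂ _  = refl
    select-++ (s ∷ σ₁) σ₂ (t ∷ ts₁) ts₂ eq with P s
    ... | true  = cong (t ∷_) (select-++ σ₁ σ₂ ts₁ ts₂ (suc-injective eq))
    ... | false = select-++ σ₁ σ₂ ts₁ ts₂ (suc-injective eq)

    select-replicate : ∀ ℓ {n} (ts : List A) → length ts ≡ n →
                       select P (replicate n ℓ) ts ≡ (if P ℓ then ts else [])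
    select-replicate ℓ [] refl with P ℓ
    ... | true  = refl
    ... | false = refl
    select-replicate ℓ (t ∷ ts) refl with P ℓ in Pℓ
    ... | true  = cong (t ∷_) (trans (select-replicate ℓ ts refl) (cong (if_then ts else []) Pℓ))
    ... | false = trans (select-replicate ℓ ts refl) (cong (if_then ts else []) Pℓ)

    select-∷-true : ∀ {s} → P s ≡ true → ∀ σ (t : A) ts → select P (s ∷ σ) (t ∷ ts) ≡ t ∷ select P σ ts
    select-∷-true Ps σ t ts rewrite Ps = refl

    select-XZZY : P Z ≡ true → ∀ (xs : List A) z₁ z₂ ys → length ys ≡ length xs →
      select P (XZZY (2 + length xs)) (xs ++ z₁ ∷ z₂ ∷ ys) ≡
      (if P X then xs else []) ++ z₁ ∷ z₂ ∷ (if P Y then ys else [])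
    select-XZZY PZ xs z₁ z₂ ys ∣ys∣ = begin
      select P (replicate n X ++ Z ∷ Z ∷ replicate n Y) (xs ++ z₁ ∷ z₂ ∷ ys)
        ≡⟨ select-++ (replicate n X) _ xs _ (length-replicate n) ⟩
      select P (replicate n X) xs ++ select P (Z ∷ Z ∷ replicate n Y) (z₁ ∷ z₂ ∷ ys)
        ≡⟨ cong₂ _++_ (select-replicate X xs refl) select-ZZ ⟩
      (if P X then xs else []) ++ z₁ ∷ z₂ ∷ (if P Y then ys else []) ∎
      where
      open ≡-Reasoning
      n : ℕ
      n = length xs
      select-ZZ : select P (Z ∷ Z ∷ replicate n Y) (z₁ ∷ z₂ ∷ ys) ≡ z₁ ∷ z₂ ∷ (if P Y then ys else [])
      select-ZZ = begin
        select P (Z ∷ Z ∷ replicate n Y) (z₁ ∷ z₂ ∷ ys) ≡⟨ select-∷-true PZ _ z₁ _ ⟩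
        z₁ ∷ select P (Z ∷ replicate n Y) (z₂ ∷ ys)     ≡⟨ cong (z₁ ∷_) (select-∷-true PZ _ z₂ ys) ⟩
        z₁ ∷ z₂ ∷ select P (replicate n Y) ys           ≡⟨ cong (λ l → z₁ ∷ z₂ ∷ l) (select-replicate Y ys ∣ys∣) ⟩
        z₁ ∷ z₂ ∷ (if P Y then ys else [])              ∎

  split-middle : ∀ {A : Set} m n (t : List A) → length t ≡ m + (2 + n) →
    ∃ λ xs → ∃₂ λ z₁ z₂ → ∃ λ ys → t ≡ xs ++ z₁ ∷ z₂ ∷ ys × length xs ≡ m × length ys ≡ n
  split-middle zero    n (z₁ ∷ z₂ ∷ ys) eq = [] , z₁ , z₂ , ys , refl , refl , suc-injective (suc-injective eq)
  split-middle (suc m) n (x ∷ t)        eq with split-middle m n t (suc-injective eq)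
  ... | xs , z₁ , z₂ , ys , refl , ∣xs∣ , ∣ys∣ = x ∷ xs , z₁ , z₂ , ys , refl , cong suc ∣xs∣ , ∣ys∣

module FinSubsets where

  open import Defs using (allSubsets)
  open import Data.Bool using (true; false)
  open import Data.Nat using (ℕ; zero; suc)
  open import Data.Fin using (Fin)
  open import Data.Fin.Properties using (_≟_)
  open import Data.Fin.Subset as Subset using (Subset; ∣_∣)
  open import Data.Vec as Vec using ([]; _∷_; lookup)
  open import Data.Vec.Properties using (tabulate-cong; tabulate∘lookup; ∷-injectiveʳ)
  open import Data.List as List using (List; map; length)
  open import Data.List.Membership.Propositional using (_∈_)
  open import Data.List.Membership.Propositional.Properties using (∈-map⁺; ∈-map⁻; ∈-++⁺ˡ; ∈-++⁺ʳ)
  import Data.List.Membership.DecPropositional as DecMembership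
  open import Data.List.Relation.Unary.Any using (here; there)
  open import Data.List.Relation.Unary.All using ([])
  open import Data.List.Relation.Unary.AllPairs using ([]; _∷_)
  open import Data.List.Relation.Unary.Unique.Propositional using (Unique)
  import Data.List.Relation.Unary.Unique.Propositional.Properties as Unique
  open import Data.List.Relation.Binary.Sublist.Propositional using (_⊆_; []; _∷_; _∷ʳ_)
  open import Data.Product using (_×_; _,_)
  open import Relation.Nullary using (¬_; contradiction)
  open import Relation.Nullary.Decidable using (does; dec-true; dec-false)
  open import Relation.Binary.PropositionalEquality using (_≡_; refl; sym; trans; cong)

  module _ {A : Set} where

    toSubset : ∀ {n} {g : Fin n → A} {xs} → xs ⊆ List.tabulate g → Subset n
    toSubset {zero}  _        = []
    toSubset {suc n} (_ ∷ʳ τ) = false ∷ toSubset τ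
    toSubset {suc n} (_ ∷ τ)  = true ∷ toSubset τ

    ∣toSubset∣ : ∀ {n} {g : Fin n → A} {xs} (τ : xs ⊆ List.tabulate g) → ∣ toSubset τ ∣ ≡ length xs
    ∣toSubset∣ {zero}  []       = refl
    ∣toSubset∣ {suc n} (_ ∷ʳ τ) = ∣toSubset∣ τ
    ∣toSubset∣ {suc n} (_ ∷ τ)  = cong suc (∣toSubset∣ τ)

    ∈-toSubset⁻ : ∀ {n} {g : Fin n → A} {xs} (τ : xs ⊆ List.tabulate g) {j} →
                  j Subset.∈ toSubset τ → g j ∈ xs
    ∈-toSubset⁻ {suc n} (_ ∷ʳ τ)   {Fin.suc j} (Vec.there j∈) = ∈-toSubset⁻ τ j∈
    ∈-toSubset⁻ {suc n} (refl ∷ τ) {Fin.zero}  Vec.here       = here refl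
    ∈-toSubset⁻ {suc n} (refl ∷ τ) {Fin.suc j} (Vec.there j∈) = there (∈-toSubset⁻ τ j∈)

  allSubsets-complete : ∀ {n} (s : Subset n) → s ∈ allSubsets n
  allSubsets-complete {zero}  []          = here refl
  allSubsets-complete {suc n} (false ∷ s) = ∈-++⁺ˡ (∈-map⁺ (false ∷_) (allSubsets-complete s))
  allSubsets-complete {suc n} (true ∷ s)  = ∈-++⁺ʳ _ (∈-map⁺ (true ∷_) (allSubsets-complete s))

  allSubsets-unique : ∀ n → Unique (allSubsets n)
  allSubsets-unique zero    = [] ∷ []
  allSubsets-unique (suc n) =
    Unique.++⁺ (Unique.map⁺ ∷-injectiveʳ (allSubsets-unique n)) (Unique.map⁺ ∷-injectiveʳ (allSubsets-unique n))
               disjoint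
    where
    disjoint : ∀ {s} → ¬ (s ∈ map (false ∷_) (allSubsets n) × s ∈ map (true ∷_) (allSubsets n))
    disjoint (s∈₀ , s∈₁) with ∈-map⁻ _ s∈₀ | ∈-map⁻ _ s∈₁
    ... | _ , _ , refl | _ , _ , ()

  module _ {n : ℕ} where
    open DecMembership (_≟_ {n}) using (_∈?_)

    subsetOf : List (Fin n) → Subset n
    subsetOf vs = Vec.tabulate (λ w → does (w ∈? vs))

    subsetOf-≡ : ∀ {vs : List (Fin n)} {e} →
                 (∀ {w} → lookup e w ≡ true → w ∈ vs) → (∀ {w} → w ∈ vs → lookup e w ≡ true) → subsetOf vs ≡ e
    subsetOf-≡ {vs = vs} {e} e⊆vs vs⊆e = trans (tabulate-cong same) (tabulate∘lookup e)
      where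
      same : ∀ w → does (w ∈? vs) ≡ lookup e w
      same w with lookup e w in ew
      ... | true  = dec-true (w ∈? vs) (e⊆vs ew)
      ... | false = dec-false (w ∈? vs) (λ w∈vs → contradiction (trans (sym (vs⊆e w∈vs)) ew) λ ())

module Arithmetic where

  open import Data.Nat using (ℕ; zero; suc; pred; _+_; _*_; _/_; _%_; _≤_; _<_; z≤n; s≤s; NonZero; >-nonZero)
  open import Data.Nat.Properties
  open import Data.Nat.DivMod using (m/n*n≤m; m≡m%n+[m/n]*n; m%n<n; /-monoˡ-≤; m*n/n≡m)
  open import Data.Nat.Tactic.RingSolver using (solve-∀)
  open import Data.Product using (_,_)
  open import Relation.Nullary using (yes; no)
  open import Relation.Binary.PropositionalEquality using (_≡_; refl; sym)

  -- ⌊D·b/B⌋; the denominator suc (pred B) differs from B only for an empty part, which never occurs here.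
  bucket : ℕ → ℕ → ℕ → ℕ
  bucket D b B = D * b / suc (pred B)

  bucket-≤ : ∀ D {b B} → b ≤ B → bucket D b B ≤ D
  bucket-≤ D {b} {B} b≤B = begin
    D * b / suc (pred B)             ≤⟨ /-monoˡ-≤ (suc (pred B)) (*-monoʳ-≤ D (≤-trans b≤B (≤-suc-pred B))) ⟩
    D * suc (pred B) / suc (pred B)  ≡⟨ m*n/n≡m D (suc (pred B)) ⟩
    D                                ∎
    where
    open ≤-Reasoning
    ≤-suc-pred : ∀ n → n ≤ suc (pred n)
    ≤-suc-pred zero    = z≤n
    ≤-suc-pred (suc n) = ≤-refl

  bucket-lower : ∀ D b {B} → 0 < B → bucket D b B * B ≤ D * b
  bucket-lower D b {suc B} _ = m/n*n≤m (D * b) (suc B)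

  bucket-upper : ∀ D b {B} → 0 < B → D * b < suc (bucket D b B) * B
  bucket-upper D b {suc B} _ = begin-strict
    D * b                                       ≡⟨ m≡m%n+[m/n]*n (D * b) (suc B) ⟩
    D * b % suc B + bucket D b (suc B) * suc B  <⟨ +-monoˡ-< _ (m%n<n (D * b) (suc B)) ⟩
    suc B + bucket D b (suc B) * suc B          ∎
    where open ≤-Reasoning

  gap-identity₁ : ∀ c e → (c + (c + e) + 4) * (c + (c + e)) ≡ 4 * (c + 1) * (c + e) + (e * e + 4 * c)
  gap-identity₁ = solve-∀

  gap-identity₂ : ∀ d e → (suc d + e + d + 4) * (suc d + e + d) ≡
                          4 * (suc d + e + 1) * d + (suc e * suc e + 4 * (suc d + e))
  gap-identity₂ = solve-∀

  -- (c + d + 4)(c + d) − 4(c + 1)d = (c − d)² + 4c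
  square-gap : ∀ c d → 0 < c + d → 4 * (c + 1) * d < (c + d + 4) * (c + d)
  square-gap c d c+d>0 with c ≤? d
  ... | yes c≤d with m≤n⇒∃[o]m+o≡n c≤d
  ...   | e , refl = begin-strict
    4 * (c + 1) * (c + e)                    <⟨ m<m+n _ (gap-pos c e c+d>0) ⟩
    4 * (c + 1) * (c + e) + (e * e + 4 * c)  ≡⟨ sym (gap-identity₁ c e) ⟩
    (c + (c + e) + 4) * (c + (c + e))        ∎
    where
    open ≤-Reasoning
    gap-pos : ∀ c e → 0 < c + (c + e) → 0 < e * e + 4 * c
    gap-pos zero    (suc e) _ = s≤s z≤n
    gap-pos (suc c) e       _ = ≤-trans (s≤s z≤n) (m≤n+m _ (e * e))
  square-gap c d c+d>0 | no c≰d with m≤n⇒∃[o]m+o≡n (≰⇒> c≰d)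
  ...   | e , refl = begin-strict
    4 * (suc d + e + 1) * d                                            <⟨ m<m+n _ (s≤s z≤n) ⟩
    4 * (suc d + e + 1) * d + (suc e * suc e + 4 * (suc d + e))        ≡⟨ sym (gap-identity₂ d e) ⟩
    (suc d + e + d + 4) * (suc d + e + d)                              ∎
    where open ≤-Reasoning

  overlap-identity₁ : ∀ D M Π B → (D + 4) * D * (M * (Π * B)) ≡ (D + 4) * (M * (Π * B)) * D
  overlap-identity₁ = solve-∀

  overlap-identity₂ : ∀ D a Π b → 4 * D * (a * (Π * b)) * D ≡ 4 * Π * (D * a) * (D * b)
  overlap-identity₂ = solve-∀

  overlap-identity₃ : ∀ c d M Π B → 4 * Π * (d * M) * (suc c * B) ≡ 4 * (c + 1) * d * (M * (Π * B))
  overlap-identity₃ = solve-∀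

  -- c: the common colour; b₁ and a: the vertices of a part of size M covered from T₁ and from T₂;
  -- B and b₂: size and covered vertices of the last part of T₂; Π: sizes of the parts in between.
  overlap-inequality : ∀ {D c M Π B a b₁ b₂} → c ≤ D → 0 < D → 0 < M → 0 < Π → 0 < B →
    c * M ≤ D * b₁ → D * b₂ < suc c * B → (D + 4) * (M * (Π * B)) ≤ 4 * D * (a * (Π * b₂)) →
    M < b₁ + a
  overlap-inequality {D} {c} {M} {Π} {B} {a} {b₁} {b₂} c≤D D>0 M>0 Π>0 B>0 lower₁ upper₂ density
    with m≤n⇒∃[o]m+o≡n c≤D
  ... | d , refl = ≰⇒> λ b₁+a≤M → <⇒≱ (square-gap c d D>0) (*-cancelʳ-≤ _ _ (M * (Π * B)) {{MΠB≢0}} (begin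
    (c + d + 4) * (c + d) * (M * (Π * B))      ≡⟨ overlap-identity₁ (c + d) M Π B ⟩
    (c + d + 4) * (M * (Π * B)) * (c + d)      ≤⟨ *-monoˡ-≤ (c + d) density ⟩
    4 * (c + d) * (a * (Π * b₂)) * (c + d)     ≡⟨ overlap-identity₂ (c + d) a Π b₂ ⟩
    4 * Π * ((c + d) * a) * ((c + d) * b₂)     ≤⟨ *-mono-≤ (*-monoʳ-≤ (4 * Π) (Da≤dM b₁+a≤M)) (<⇒≤ upper₂) ⟩
    4 * Π * (d * M) * (suc c * B)              ≡⟨ overlap-identity₃ c d M Π B ⟩
    4 * (c + 1) * d * (M * (Π * B))            ∎))
    where
    open ≤-Reasoning
    MΠB≢0 : NonZero (M * (Π * B))
    MΠB≢0 = >-nonZero (*-mono-< M>0 (*-mono-< Π>0 B>0))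
    Da≤dM : b₁ + a ≤ M → (c + d) * a ≤ d * M
    Da≤dM b₁+a≤M = +-cancelʳ-≤ (c * M) _ _ (begin
      (c + d) * a + c * M          ≤⟨ +-monoʳ-≤ _ lower₁ ⟩
      (c + d) * a + (c + d) * b₁   ≡⟨ sym (*-distribˡ-+ (c + d) a b₁) ⟩
      (c + d) * (a + b₁)           ≤⟨ *-monoʳ-≤ (c + d) (≤-trans (≤-reflexive (+-comm a b₁)) b₁+a≤M) ⟩
      (c + d) * M                  ≡⟨ *-distribʳ-+ M c d ⟩
      c * M + d * M                ≡⟨ +-comm (c * M) (d * M) ⟩
      d * M + c * M                ∎)

module Rationals where

  open import Data.Nat using (ℕ; zero; suc; _+_; _*_; _≤_; _<_; z≤n; s≤s)
  open import Data.Nat.Properties using (*-monoˡ-≤; +-monoʳ-≤; *-identityʳ; *-comm; module ≤-Reasoning)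
  open import Data.Integer as ℤ using (+_; -[1+_]; +<+)
  import Data.Integer.Properties as ℤ
  open import Data.Rational as ℚ using (ℚ; mkℚ; 0ℚ; _/_; *<*; toℚᵘ)
  open import Data.Rational.Properties using (toℚᵘ-mono-≤; toℚᵘ-homo-*; toℚᵘ-homo-+; toℚᵘ-fromℚᵘ)
  open import Data.Rational.Unnormalised as ℚᵘ using (mkℚᵘ)
  open import Data.Rational.Unnormalised.Properties
    using (≤-respˡ-≃; ≤-respʳ-≃; ≃-trans; ≃-refl; *-cong; +-cong; drop-*≤*)
  open import Data.Product using (∃; _×_; _,_)
  open import Relation.Binary.PropositionalEquality using (_≡_; sym; cong; subst₂; module ≡-Reasoning)

  -- the numerator of (1/4 + N/D) · (P/1) as computed in ℚᵘ
  numerator-identity : ∀ D N P → ((+ 1 ℤ.* + D ℤ.+ + N ℤ.* + 4) ℤ.* + P) ℤ.* + 1 ≡ + ((D + N * 4) * P * 1)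
  numerator-identity D N P = begin
    ((+ 1 ℤ.* + D ℤ.+ + N ℤ.* + 4) ℤ.* + P) ℤ.* + 1
      ≡⟨ cong (λ x → ((x ℤ.+ + N ℤ.* + 4) ℤ.* + P) ℤ.* + 1) (ℤ.*-identityˡ (+ D)) ⟩
    ((+ D ℤ.+ + N ℤ.* + 4) ℤ.* + P) ℤ.* + 1
      ≡⟨ cong (λ x → ((+ D ℤ.+ x) ℤ.* + P) ℤ.* + 1) (sym (ℤ.pos-* N 4)) ⟩
    ((+ D ℤ.+ + (N * 4)) ℤ.* + P) ℤ.* + 1
      ≡⟨ cong (λ x → (x ℤ.* + P) ℤ.* + 1) (sym (ℤ.pos-+ D (N * 4))) ⟩
    (+ (D + N * 4) ℤ.* + P) ℤ.* + 1
      ≡⟨ cong (ℤ._* + 1) (sym (ℤ.pos-* (D + N * 4) P)) ⟩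
    + ((D + N * 4) * P) ℤ.* + 1
      ≡⟨ sym (ℤ.pos-* ((D + N * 4) * P) 1) ⟩
    + ((D + N * 4) * P * 1)
      ∎
    where open ≡-Reasoning

  density-bound : ∀ (ε : ℚ) → 0ℚ ℚ.< ε → ∃ λ D → 0 < D ×
    (∀ P E → (+ 1 / 4 ℚ.+ ε) ℚ.* (+ P / 1) ℚ.≤ + E / 1 → (D + 4) * P ≤ 4 * D * E)
  density-bound (mkℚ (+ zero)   _ _) (*<* (+<+ ()))
  density-bound (mkℚ -[1+ _ ]   _ _) (*<* ())
  density-bound ε@(mkℚ (+ suc n) d-1 _) _ = D , s≤s z≤n , bound
    where
    D N : ℕ
    D = suc d-1
    N = suc n
    bound : ∀ P E → (+ 1 / 4 ℚ.+ ε) ℚ.* (+ P / 1) ℚ.≤ + E / 1 → (D + 4) * P ≤ 4 * D * E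
    bound P E h = begin
      (D + 4) * P          ≤⟨ *-monoˡ-≤ P (+-monoʳ-≤ D (*-monoˡ-≤ 4 {1} {N} (s≤s z≤n))) ⟩
      (D + N * 4) * P      ≡⟨ sym (*-identityʳ _) ⟩
      (D + N * 4) * P * 1  ≤⟨ ℤ.drop‿+≤+ (subst₂ ℤ._≤_ (numerator-identity D N P) (sym (ℤ.pos-* E (4 * D * 1)))
                                                   (drop-*≤* hᵘ)) ⟩
      E * (4 * D * 1)      ≡⟨ cong (E *_) (*-identityʳ (4 * D)) ⟩
      E * (4 * D)          ≡⟨ *-comm E (4 * D) ⟩
      4 * D * E            ∎
      where
      open ≤-Reasoning
      hᵘ : (mkℚᵘ (+ 1) 3 ℚᵘ.+ mkℚᵘ (+ N) d-1) ℚᵘ.* mkℚᵘ (+ P) 0 ℚᵘ.≤ mkℚᵘ (+ E) 0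
      hᵘ = ≤-respʳ-≃ (toℚᵘ-fromℚᵘ (mkℚᵘ (+ E) 0)) (≤-respˡ-≃ lhs≃ (toℚᵘ-mono-≤ h))
        where
        lhs≃ : toℚᵘ ((+ 1 / 4 ℚ.+ ε) ℚ.* (+ P / 1)) ℚᵘ.≃
               (mkℚᵘ (+ 1) 3 ℚᵘ.+ mkℚᵘ (+ N) d-1) ℚᵘ.* mkℚᵘ (+ P) 0
        lhs≃ = ≃-trans (toℚᵘ-homo-* (+ 1 / 4 ℚ.+ ε) (+ P / 1))
                 (*-cong (≃-trans (toℚᵘ-homo-+ (+ 1 / 4) ε)
                                  (+-cong (toℚᵘ-fromℚᵘ (mkℚᵘ (+ 1) 3)) (≃-refl {mkℚᵘ (+ N) d-1})))
                         (toℚᵘ-fromℚᵘ (mkℚᵘ (+ P) 0)))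

module ReducedHypergraphs where

  open import Defs
  open import Data.Bool using (Bool; true; _∧_; _∨_; not)
  open import Data.Bool.Properties using (T-≡)
  open import Data.Bool.ListAction using (any)
  open import Data.Nat as ℕ using (ℕ; suc; _+_; _*_; _∸_; _≤_; _<_; z≤n; s≤s)
  import Data.Nat.Properties as ℕ
  open import Data.Nat.ListAction using (product)
  open import Data.Fin as Fin using (Fin; toℕ; fromℕ<)
  open import Data.Fin.Properties as Fin using (_≟_; <-trans; <-irrefl)
  open import Data.Fin.Subset as Subset using (Subset; ∣_∣)
  open import Data.Vec using (lookup)
  open import Data.List as List using (List; []; _∷_; _++_; map; length; allFin; filterᵇ; last)
  open import Data.List.Properties using (length-++; length-map; length-tabulate; map-∘; map-cong)
  open import Data.List.Membership.Propositional using (_∈_)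
  open import Data.List.Membership.Propositional.Properties using (∈-allFin; ∈-map⁺; ∈-++⁺ˡ; ∈-++⁺ʳ; ∈-filter⁺)
  open import Data.List.Relation.Unary.Any using (here; there)
  open import Data.List.Relation.Unary.All as All using (All; []; _∷_)
  open import Data.List.Relation.Unary.AllPairs using (AllPairs; []; _∷_)
  open import Data.List.Relation.Unary.AllPairs.Properties using (tabulate⁺-<)
  open import Data.List.Relation.Unary.Linked.Properties using (Linked⇒AllPairs; AllPairs⇒Linked)
  open import Data.List.Relation.Binary.Pointwise using (Pointwise; []; _∷_)
  open import Data.List.Relation.Binary.Equality.Propositional using (≋⇒≡)
  open import Data.List.Relation.Binary.Sublist.Propositional using (_⊆_; _∷_; minimum; ⊆-refl; ⊆-trans)
  open import Data.List.Relation.Binary.Sublist.Propositional.Properties using (to-≋; ++⁺; ++⁺ˡ)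
  open import Data.Maybe using (just; nothing; maybe)
  open import Data.Product as Product using (∃; _×_; _,_; proj₁; proj₂)
  open import Data.Sum using (inj₁; inj₂)
  open import Function using (_∘_; id)
  open import Function.Bundles using (Equivalence)
  open import Relation.Nullary using (yes; no; contradiction)
  open import Relation.Nullary.Decidable using (T?)
  open import Relation.Binary.PropositionalEquality using (_≡_; refl; sym; trans; cong; cong₂; subst)
  open Ramsey using (Monochromatic; IsRamseyBound)
  open Pairs
  open SortedLists
  open Counting
  open DescriptiveSequences
  open FinSubsets
  open Arithmetic

  module _ {k r : ℕ} (H : ReducedHG k r) where
    open ReducedHG H

    part : Fin n → Fin k × Fin k
    part v = p₁ v , p₂ v

    pairSize : Fin k × Fin k → ℕ
    pairSize p = partSize H (proj₁ p) (proj₂ p)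

    inPart⁻ : ∀ {a b v} → inPart H a b v ≡ true → part v ≡ (a , b)
    inPart⁻ {a} {b} {v} h with p₁ v ≟ a | p₂ v ≟ b
    inPart⁻ h  | yes refl | yes refl = refl
    inPart⁻ () | yes _    | no _
    inPart⁻ () | no _     | _

    inPart⁺ : ∀ {a b v} → part v ≡ (a , b) → inPart H a b v ≡ true
    inPart⁺ {v = v} refl with p₁ v ≟ p₁ v | p₂ v ≟ p₂ v
    ... | yes _  | yes _  = refl
    ... | yes _  | no ¬eq = contradiction refl ¬eq
    ... | no ¬eq | _      = contradiction refl ¬eq

    inConst⁻ : ∀ {T e} → inConst H T e ≡ true →
               edge e ≡ true × (∀ {w} → lookup e w ≡ true → part w ∈ pairsOf T)
    inConst⁻ {T} {e} h with ∧-true⁻ h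
    ... | isEdge , inside = isEdge , part∈
      where
      part∈ : ∀ {w} → lookup e w ≡ true → part w ∈ pairsOf T
      part∈ {w} ew with any-true⁻ _ (pairsOf T) (subst (λ b → not b ∨ inUnion H T w ≡ true) ew
                                                       (all-true⁻ _ inside (∈-allFin w)))
      ... | ab , ab∈ , w∈ab = subst (_∈ pairsOf T) (sym (inPart⁻ w∈ab)) ab∈

    inSomeEdge : List (Fin k) → Fin n → Bool
    inSomeEdge T v = any (λ e → inConst H T e ∧ lookup e v) (allSubsets n)

    covered : List (Fin k) → Fin k × Fin k → Fin n → Bool
    covered T p v = inPart H (proj₁ p) (proj₂ p) v ∧ inSomeEdge T v

    coveredCount : List (Fin k) → Fin k × Fin k → ℕ
    coveredCount T p = count (covered T p) (allFin n)

    covered⁻ : ∀ {T p v} → covered T p v ≡ true →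
               part v ≡ p × ∃ λ e → inConst H T e ≡ true × lookup e v ≡ true
    covered⁻ {T} {v = v} h with ∧-true⁻ h
    ... | v∈p , v∈e with any-true⁻ (λ e → inConst H T e ∧ lookup e v) (allSubsets n) v∈e
    ...   | e , _ , eT∧ev = inPart⁻ v∈p , e , ∧-true⁻ eT∧ev

    covered⁺ : ∀ {T p v e} → part v ≡ p → inConst H T e ≡ true → lookup e v ≡ true → covered T p v ≡ true
    covered⁺ {e = e} refl eT ev = ∧-true⁺ (inPart⁺ refl) (any-true⁺ _ (allSubsets-complete e) (∧-true⁺ eT ev))

    coveredCount-≤ : ∀ T p → coveredCount T p ≤ pairSize p
    coveredCount-≤ T p = count-mono (λ _ → proj₁ ∘ ∧-true⁻) (allFin n)

    pairSize-pos : ∀ {a b} → a Fin.< b → 0 < pairSize (a , b)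
    pairSize-pos a<b with nonempty _ _ a<b
    ... | v , refl , refl = count-pos (∈-allFin v) (inPart⁺ refl)

    -- e ∩ V_{a,b} = {v}, in the form used by ReducedHG.reduced
    MeetsPartAt : Subset n → Fin k → Fin k → Fin n → Set
    MeetsPartAt e a b v = (lookup e v ≡ true × p₁ v ≡ a × p₂ v ≡ b) ×
                          (∀ w → lookup e w ≡ true → p₁ w ≡ a → p₂ w ≡ b → w ≡ v)

    edge-tuple-∈ : ∀ {T e t} → inConst H T e ≡ true → 2 ≤ length t →
      (∀ a b → (a , b) ∈ pairsOf t → ∃ (MeetsPartAt e a b)) → ∀ {x} → x ∈ t → x ∈ T
    edge-tuple-∈ {t = _ ∷ []} _ (s≤s ()) _ _
    edge-tuple-∈ {T} {t = _ ∷ _ ∷ _} eT _ meets x∈t with ∈⇒∈-pairsOf x∈t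
    ... | _ , inj₁ xy∈ with meets _ _ xy∈
    ...   | _ , (ev , refl , _) , _ = proj₁ (∈-pairsOf⁻ (proj₂ (inConst⁻ {T} eT) ev))
    edge-tuple-∈ {T} {t = _ ∷ _ ∷ _} eT _ meets x∈t | _ , inj₂ yx∈ with meets _ _ yx∈
    ...   | _ , (ev , _ , refl) , _ = proj₂ (∈-pairsOf⁻ (proj₂ (inConst⁻ {T} eT) ev))

    constituent-edge-meets-part : ∀ {T e} → IncTuple k r T → 2 ≤ r → inConst H T e ≡ true →
      ∀ {a b} → (a , b) ∈ pairsOf T → ∃ (MeetsPartAt e a b)
    constituent-edge-meets-part {T} {e} (∣T∣ , T-inc) 2≤r eT {a} {b} with reduced e (proj₁ (inConst⁻ {T} eT))
    ... | t , (∣t∣ , t-inc) , meets =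
      subst (λ t → (a , b) ∈ pairsOf t → ∃ (MeetsPartAt e a b)) t≡T (meets a b)
      where
      t⊆T : t ⊆ T
      t⊆T = sorted-∈⇒⊆ <-trans <-irrefl (Linked⇒AllPairs <-trans t-inc) (Linked⇒AllPairs <-trans T-inc)
                     (edge-tuple-∈ eT (subst (2 ≤_) (sym ∣t∣) 2≤r) meets)
      t≡T : t ≡ T
      t≡T = ≋⇒≡ (to-≋ (trans ∣t∣ (sym ∣T∣)) t⊆T)

    Transversal : Subset n → List (Fin k × Fin k) → Set
    Transversal e = All (λ p → ∃ (MeetsPartAt e (proj₁ p) (proj₂ p)))

    vertices : ∀ {e ps} → Transversal e ps → List (Fin n)
    vertices = All.reduce proj₁

    ∈-vertices⁻ : ∀ {e ps w} (ms : Transversal e ps) → w ∈ vertices {e} ms → lookup e w ≡ true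
    ∈-vertices⁻ ((_ , (ev , _) , _) ∷ _)  (here refl) = ev
    ∈-vertices⁻ {e} (_ ∷ ms)              (there w∈)  = ∈-vertices⁻ {e} ms w∈

    ∈-vertices⁺ : ∀ {e ps w} (ms : Transversal e ps) → lookup e w ≡ true → part w ∈ ps →
                  w ∈ vertices {e} ms
    ∈-vertices⁺ {w = w} ((_ , _ , unique) ∷ _) ew (here refl) = here (unique w ew refl refl)
    ∈-vertices⁺ {e} (_ ∷ ms) ew (there w∈) = there (∈-vertices⁺ {e} ms ew w∈)

    coveredList : List (Fin k) → Fin k × Fin k → List (Fin n)
    coveredList T p = filterᵇ (covered T p) (allFin n)

    vertices-covered : ∀ {T e ps} → inConst H T e ≡ true → (ms : Transversal e ps) →
                       Pointwise _∈_ (vertices {e} ms) (map (coveredList T) ps)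
    vertices-covered eT [] = []
    vertices-covered {T} {e} {p ∷ _} eT ((v , (ev , p₁v≡ , p₂v≡) , _) ∷ ms) =
      ∈-filter⁺ (T? ∘ covered T p) (∈-allFin v)
                (Equivalence.from T-≡ (covered⁺ {T} (cong₂ _,_ p₁v≡ p₂v≡) eT ev))
      ∷ vertices-covered {T} {e} eT ms

    -- An edge of A_T is the set of its vertices, one covered vertex in each part of T.
    edgeCount-≤ : ∀ {T} → IncTuple k r T → 2 ≤ r → edgeCount H T ≤ product (map (coveredCount T) (pairsOf T))
    edgeCount-≤ {T} T-inc 2≤r = begin
      count (inConst H T) (allSubsets n)          ≤⟨ count-≤-length (inConst H T) (allSubsets-unique n) edge∈ ⟩
      length (map subsetOf (choices Cs))          ≡⟨ length-map subsetOf (choices Cs) ⟩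
      length (choices Cs)                         ≡⟨ length-choices Cs ⟩
      product (map length Cs)                     ≡⟨ cong product (trans (sym (map-∘ (pairsOf T)))
                                                                         (map-cong length-coveredList (pairsOf T))) ⟩
      product (map (coveredCount T) (pairsOf T))  ∎
      where
      open ℕ.≤-Reasoning
      Cs : List (List (Fin n))
      Cs = map (coveredList T) (pairsOf T)
      length-coveredList : ∀ p → length (coveredList T p) ≡ coveredCount T p
      length-coveredList p = length-filterᵇ (covered T p) (allFin n)
      edge∈ : ∀ {e} → e ∈ allSubsets n → inConst H T e ≡ true → e ∈ map subsetOf (choices Cs)
      edge∈ {e} _ eT = subst (_∈ map subsetOf (choices Cs))
                             (subsetOf-≡ (λ ew → ∈-vertices⁺ {e} ms ew (proj₂ (inConst⁻ {T} eT) ew)) (∈-vertices⁻ {e} ms))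
                             (∈-map⁺ subsetOf (∈-choices (vertices-covered {T} {e} eT ms)))
        where
        ms : Transversal e (pairsOf T)
        ms = All.tabulate (constituent-edge-meets-part {T} T-inc 2≤r eT)

    lastBucket : ℕ → List (Fin k) → ℕ
    lastBucket D T = maybe (λ p → bucket D (coveredCount T p) (pairSize p)) 0 (last (pairsOf T))

    lastBucket-≤ : ∀ D T → lastBucket D T ≤ D
    lastBucket-≤ D T with last (pairsOf T)
    ... | nothing = z≤n
    ... | just p  = bucket-≤ D (coveredCount-≤ T p)

    colour : (D : ℕ) → List (Fin k) → Fin (suc D)
    colour D T = fromℕ< (s≤s (lastBucket-≤ D T))

    colour-≡⇒lastBucket-≡ : ∀ D {T₁ T₂} → colour D T₁ ≡ colour D T₂ → lastBucket D T₁ ≡ lastBucket D T₂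
    colour-≡⇒lastBucket-≡ D {T₁} {T₂} eq =
      trans (sym (Fin.toℕ-fromℕ< (s≤s (lastBucket-≤ D T₁))))
            (trans (cong toℕ eq) (Fin.toℕ-fromℕ< (s≤s (lastBucket-≤ D T₂))))

    -- density at least 1/4 + 1/D, with the denominators cleared
    Dense : ℕ → Set
    Dense D = ∀ T → IncTuple k r T → (D + 4) * partProduct H T ≤ 4 * D * edgeCount H T

    dense⇒covered-first-last : ∀ {D T p mid q} → Dense D → IncTuple k r T → 2 ≤ r →
      pairsOf T ≡ p ∷ mid ++ q ∷ [] →
      (D + 4) * (pairSize p * (product (map pairSize mid) * pairSize q)) ≤
      4 * D * (coveredCount T p * (product (map pairSize mid) * coveredCount T q))
    dense⇒covered-first-last {D} {T} {p} {mid} {q} dense T-inc 2≤r pairs≡ = begin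
      (D + 4) * (pairSize p * (Π * pairSize q))                  ≡⟨ cong ((D + 4) *_) (sym partProduct≡) ⟩
      (D + 4) * partProduct H T                                  ≤⟨ dense T T-inc ⟩
      4 * D * edgeCount H T                                      ≤⟨ ℕ.*-monoʳ-≤ (4 * D) (edgeCount-≤ T-inc 2≤r) ⟩
      4 * D * product (map (coveredCount T) (pairsOf T))         ≡⟨ cong (4 * D *_) covered≡ ⟩
      4 * D * (coveredCount T p * (product (map (coveredCount T) mid) * coveredCount T q))
        ≤⟨ ℕ.*-monoʳ-≤ (4 * D) (ℕ.*-monoʳ-≤ (coveredCount T p)
             (ℕ.*-monoˡ-≤ (coveredCount T q) (product-map-mono mid (coveredCount-≤ T)))) ⟩
      4 * D * (coveredCount T p * (Π * coveredCount T q))        ∎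
      where
      open ℕ.≤-Reasoning
      Π : ℕ
      Π = product (map pairSize mid)
      partProduct≡ : partProduct H T ≡ pairSize p * (Π * pairSize q)
      partProduct≡ = trans (cong (product ∘ map pairSize) pairs≡) (product-first-last pairSize p mid q)
      covered≡ : product (map (coveredCount T) (pairsOf T)) ≡
                 coveredCount T p * (product (map (coveredCount T) mid) * coveredCount T q)
      covered≡ = trans (cong (product ∘ map (coveredCount T)) pairs≡) (product-first-last (coveredCount T) p mid q)

    equal-colours⇒common-covered-vertex : ∀ {D} → 0 < D → Dense D → ∀ xs z₁ z₂ y ys →
      IncTuple k r (xs ++ z₁ ∷ z₂ ∷ []) → IncTuple k r (z₁ ∷ z₂ ∷ y ∷ ys) →
      lastBucket D (xs ++ z₁ ∷ z₂ ∷ []) ≡ lastBucket D (z₁ ∷ z₂ ∷ y ∷ ys) →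
      ∃ λ v → covered (xs ++ z₁ ∷ z₂ ∷ []) (z₁ , z₂) v ≡ true ×
              covered (z₁ ∷ z₂ ∷ y ∷ ys) (z₁ , z₂) v ≡ true
    equal-colours⇒common-covered-vertex {D} D>0 dense xs z₁ z₂ y ys T₁-inc T₂-inc same-bucket
      with pairsOf-first-last z₁ z₂ y ys
    ... | mid , q , pairs≡ , last≡ =
      Product.map₂ proj₂ (count-overlap (λ _ → proj₁ ∘ ∧-true⁻) (λ _ → proj₁ ∘ ∧-true⁻) (allFin n)
        (overlap-inequality (lastBucket-≤ D T₁) D>0 M>0 Π>0 B>0 lower upper
                            (dense⇒covered-first-last {D} dense T₂-inc 2≤r pairs≡)))
      where
      T₁ T₂ : List (Fin k)
      T₁ = xs ++ z₁ ∷ z₂ ∷ []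
      T₂ = z₁ ∷ z₂ ∷ y ∷ ys
      2≤r : 2 ≤ r
      2≤r = subst (2 ≤_) (proj₁ T₂-inc) (s≤s (s≤s z≤n))
      pair-pos : ∀ {p} → p ∈ pairsOf T₂ → 0 < pairSize p
      pair-pos p∈ = pairSize-pos (AllPairs⇒pairsOf (Linked⇒AllPairs <-trans (proj₂ T₂-inc)) p∈)
      M>0 : 0 < pairSize (z₁ , z₂)
      M>0 = pair-pos (here refl)
      B>0 : 0 < pairSize q
      B>0 = pair-pos (subst (q ∈_) (sym pairs≡) (there (∈-++⁺ʳ mid (here refl))))
      Π>0 : 0 < product (map pairSize mid)
      Π>0 = product-map-pos mid (λ {p} p∈ → pair-pos (subst (p ∈_) (sym pairs≡) (there (∈-++⁺ˡ p∈))))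
      bucket₁ : lastBucket D T₁ ≡ bucket D (coveredCount T₁ (z₁ , z₂)) (pairSize (z₁ , z₂))
      bucket₁ = cong (maybe _ 0) (last-pairsOf-++ xs z₁ z₂)
      bucket₂ : lastBucket D T₁ ≡ bucket D (coveredCount T₂ q) (pairSize q)
      bucket₂ = trans same-bucket (cong (maybe _ 0) last≡)
      lower : lastBucket D T₁ * pairSize (z₁ , z₂) ≤ D * coveredCount T₁ (z₁ , z₂)
      lower = subst (λ c → c * pairSize (z₁ , z₂) ≤ D * coveredCount T₁ (z₁ , z₂)) (sym bucket₁)
                    (bucket-lower D _ M>0)
      upper : D * coveredCount T₂ q < suc (lastBucket D T₁) * pairSize q
      upper = subst (λ c → D * coveredCount T₂ q < suc c * pairSize q) (sym bucket₂) (bucket-upper D _ B>0)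

    common-covered-vertex⇒admits : ∀ xs z₁ z₂ ys → length ys ≡ length xs →
      AllPairs Fin._<_ (xs ++ z₁ ∷ z₂ ∷ ys) →
      IncTuple k r (z₁ ∷ z₂ ∷ ys) → 2 ≤ r → ∀ {v} →
      covered (xs ++ z₁ ∷ z₂ ∷ []) (z₁ , z₂) v ≡ true → covered (z₁ ∷ z₂ ∷ ys) (z₁ , z₂) v ≡ true →
      Admits H (XZZY (2 + length xs)) (xs ++ z₁ ∷ z₂ ∷ ys)
    common-covered-vertex⇒admits xs z₁ z₂ ys ∣ys∣ sorted T₂-inc 2≤r {v} v∈₁ v∈₂
      with covered⁻ {xs ++ z₁ ∷ z₂ ∷ []} v∈₁ | covered⁻ {z₁ ∷ z₂ ∷ ys} v∈₂
    ... | part-v , eX , eX∈ , v∈eX | _ , eY , eY∈ , v∈eY =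
      eX , eY , v ,
      subst (λ T → inConst H T eX ≡ true) (sym (select-XZZY isXZ refl xs z₁ z₂ ys ∣ys∣)) eX∈ ,
      subst (λ T → inConst H T eY ≡ true) (sym (select-XZZY isYZ refl xs z₁ z₂ ys ∣ys∣)) eY∈ ,
      only-v , v∈eX , v∈eY ,
      trans (select-XZZY isZ refl xs z₁ z₂ ys ∣ys∣) (cong (λ p → proj₁ p ∷ proj₂ p ∷ []) (sym part-v))
      where
      -- A common vertex of eX and eY lies in a part shared by both halves, i.e. in V_{z₁z₂},
      -- where eY has only one vertex.
      only-v : ∀ w → (lookup eX w ∧ lookup eY w) ≡ true → w ≡ v
      only-v w w∈eX∩eY
        with ∧-true⁻ w∈eX∩eY | constituent-edge-meets-part {z₁ ∷ z₂ ∷ ys} T₂-inc 2≤r eY∈ (here refl)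
      ... | w∈eX , w∈eY | _ , _ , unique =
        trans (unique w w∈eY (cong proj₁ part-w) (cong proj₂ part-w))
              (sym (unique v v∈eY (cong proj₁ part-v) (cong proj₂ part-v)))
        where
        part-w : part w ≡ (z₁ , z₂)
        part-w = pairsOf-both-halves <-trans <-irrefl xs sorted
                   (proj₂ (inConst⁻ {xs ++ z₁ ∷ z₂ ∷ []} eX∈) w∈eX) (proj₂ (inConst⁻ {z₁ ∷ z₂ ∷ ys} eY∈) w∈eY)

  2[3+s]∸2 : ∀ s → 2 * (3 + s) ∸ 2 ≡ suc s + (2 + suc s)
  2[3+s]∸2 s = cong (λ m → suc s + (2 + suc m)) (ℕ.+-identityʳ s)

  monochromatic⇒admits : ∀ {k s D} (H : ReducedHG k (3 + s)) → 0 < D → Dense H D →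
    ∀ {i U} → AllPairs Fin._<_ U → Monochromatic (colour H D) (3 + s) i U →
    ∀ t → IncTuple k (2 * (3 + s) ∸ 2) t → (∀ {x} → x ∈ t → x ∈ U) → Admits H (XZZY (3 + s)) t
  monochromatic⇒admits {k} {s} {D} H D>0 dense {U = U} U-sorted U-mono t (∣t∣ , t-inc) t∈U
    with split-middle (suc s) (suc s) t (trans ∣t∣ (2[3+s]∸2 s))
  ... | xs , z₁ , z₂ , [] , _ , _ , ()
  ... | xs , z₁ , z₂ , y ∷ ys , refl , ∣xs∣ , ∣ys∣ =
    let v , v∈₁ , v∈₂ =
          equal-colours⇒common-covered-vertex H D>0 dense xs z₁ z₂ y ys T₁-inc T₂-inc same-bucket
    in subst (λ m → Admits H (XZZY (2 + m)) t) ∣xs∣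
         (common-covered-vertex⇒admits H xs z₁ z₂ (y ∷ ys) (trans ∣ys∣ (sym ∣xs∣)) t-sorted T₂-inc
                                       (s≤s (s≤s z≤n)) v∈₁ v∈₂)
    where
    T₁ T₂ : List (Fin k)
    T₁ = xs ++ z₁ ∷ z₂ ∷ []
    T₂ = z₁ ∷ z₂ ∷ y ∷ ys
    t-sorted : AllPairs Fin._<_ t
    t-sorted = Linked⇒AllPairs <-trans t-inc
    t⊆U : t ⊆ U
    t⊆U = sorted-∈⇒⊆ <-trans <-irrefl t-sorted U-sorted t∈U
    T₁⊆t : T₁ ⊆ t
    T₁⊆t = ++⁺ ⊆-refl (refl ∷ refl ∷ minimum _)
    T₂⊆t : T₂ ⊆ t
    T₂⊆t = ++⁺ˡ xs ⊆-refl
    ∣T₁∣ : length T₁ ≡ 3 + s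
    ∣T₁∣ = trans (length-++ xs) (trans (cong (_+ 2) ∣xs∣) (ℕ.+-comm (suc s) 2))
    ∣T₂∣ : length T₂ ≡ 3 + s
    ∣T₂∣ = cong (2 +_) ∣ys∣
    T₁-inc : IncTuple k (3 + s) T₁
    T₁-inc = ∣T₁∣ , AllPairs⇒Linked (AllPairs-resp-⊆ T₁⊆t t-sorted)
    T₂-inc : IncTuple k (3 + s) T₂
    T₂-inc = ∣T₂∣ , AllPairs⇒Linked (AllPairs-resp-⊆ T₂⊆t t-sorted)
    same-bucket : lastBucket H D T₁ ≡ lastBucket H D T₂
    same-bucket = colour-≡⇒lastBucket-≡ H D {T₁} {T₂}
      (trans (U-mono T₁ (⊆-trans T₁⊆t t⊆U) ∣T₁∣) (sym (U-mono T₂ (⊆-trans T₂⊆t t⊆U) ∣T₂∣)))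

  dense⇒admitting-subset : ∀ {k s D m} (H : ReducedHG k (3 + s)) → 0 < D → Dense H D →
    IsRamseyBound (3 + s) (suc D) (λ _ → m) k →
    ∃ λ (S : Subset k) → ∣ S ∣ ≡ m ×
      (∀ t → IncTuple k (2 * (3 + s) ∸ 2) t → All (Subset._∈ S) t → Admits H (XZZY (3 + s)) t)
  dense⇒admitting-subset {k} {D = D} H D>0 dense k-bound
    with k-bound (allFin k) (ℕ.≤-reflexive (sym (length-tabulate id))) (colour H D)
  ... | _ , U , U⊆ , ∣U∣ , U-mono =
    toSubset U⊆ , trans (∣toSubset∣ U⊆) ∣U∣ ,
    λ t t-inc t∈S → monochromatic⇒admits H D>0 dense (AllPairs-resp-⊆ U⊆ (tabulate⁺-< id)) U-mono t t-inc
                      (∈-toSubset⁻ U⊆ ∘ All.lookup t∈S)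

open import Defs
open import Data.Nat using (ℕ; _≤_; _*_; _∸_)
open import Data.Integer using (+_)
open import Data.Rational using (ℚ; 0ℚ; _/_; _+_) renaming (_<_ to _<ℚ_)
open import Data.Fin using (Fin)
open import Data.Fin.Subset using (Subset; ∣_∣; _∈_)
open import Data.List using (List)
open import Data.List.Relation.Unary.All using (All)
open import Data.Product using (∃; _×_)
open import Relation.Binary.PropositionalEquality using (_≡_)
open import Data.Nat using (suc; s≤s; z≤n)
open import Data.Product using (_,_)
open Ramsey using (ramsey)
open Rationals using (density-bound)
open ReducedHypergraphs using (dense⇒admitting-subset)

lemma5p1 : ∀ (ε : ℚ) → 0ℚ <ℚ ε → ∀ (r m : ℕ) → 3 ≤ r → 1 ≤ m →
    ∃ λ (k : ℕ) → ∀ (H : ReducedHG k r) → HasDensity H ((+ 1 / 4) + ε) →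
      ∃ λ (S : Subset k) → ∣ S ∣ ≡ m ×
        (∀ (t : List (Fin k)) → IncTuple k (2 * r ∸ 2) t → All (_∈ S) t →
           Admits H (XZZY r) t)
lemma5p1 ε ε>0 (suc (suc (suc s))) m (s≤s (s≤s (s≤s z≤n))) _ with density-bound ε ε>0
... | D , D>0 , bound with ramsey (suc (suc (suc s))) (suc D) (λ _ → m)
...   | k , k-bound =
  k , λ H H-dense → dense⇒admitting-subset H D>0 (λ T T-inc → bound _ _ (H-dense T T-inc)) k-bound
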